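{- Let $G_{\mathrm{maj}}=(\{x,y\},\{x_j\mapsto q^jx_0y_0,\ y_j\mapsto q^jx_0y_0\},\mathrm{LPO})$, let $D$ be its $q$-derivative, and let $\phi$ be the evaluation $\phi(x_j)=xq^j$, $\phi(y_j)=yq^j$. Then for every $n\ge1$, $$\phi\big(D^n(x_0)\big)=A^{\mathrm{maj}}_n(q;x,y)=\sum_{\sigma\in\mathfrak{S}_n}q^{\mathrm{maj}(\sigma)}x^{\mathrm{asc}(\sigma)}y^{\mathrm{des}(\sigma)}.$$
   Context: $\mathbb{K}$ is a commutative ring with unity of characteristic zero, $q$ an indeterminate. Variables $x_i,y_i$ ($i\ge0$) form $\mathbb{S}$; $\mathbb{E}=\mathbb{K}[q][F(\mathbb{S})]$ is the group algebra of the free group on $\mathbb{S}$. The rule is $R(x_j)=q^jx_0y_0$, $R(y_j)=q^jx_0y_0$, extended by $R(s_i^{ -1})=-s_i^{ -1}R(s_i)s_{i+1}^{ -1}$. $\uparrow$ is the $\mathbb{K}[q]$-linear map replacing every letter $s_i^{\pm1}$ by $s_{i+1}^{\pm1}$. LPO rewrites a word by stably sorting its letters according to $x_0<x_1<x_2<\cdots<y_0<y_1<\cdots$ (extended linearly). The $q$-derivative is the $\mathbb{K}[q]$-linear map $D(w_1\cdots w_n)=\sum_{j=1}^n\mathrm{LPO}\big(w_1\cdots w_{j-1}R(w_j)\uparrow(w_{j+1}\cdots w_n)\big)$, $D^n$ its iterate. The evaluation $\phi$ is extended to a $\mathbb{K}[q]$-algebra homomorphism from $\mathbb{E}$ to $\mathbb{K}[q,q^{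 -1},x^{\pm1},y^{\pm1}]$. For $\sigma\in\mathfrak{S}_n$ with $\sigma_0=\sigma_{n+1}=0$: an index $0\le i\le n$ is a descent if $\sigma_i>\sigma_{i+1}$ and an ascent if $\sigma_i<\sigma_{i+1}$; $\mathrm{des},\mathrm{asc}$ count them; $\mathrm{maj}(\sigma)=\sum_{1\le i\le n-1,\ \sigma_i>\sigma_{i+1}}i$. -}

module Defs where

open import Data.Bool using (Bool; true; false; if_then_else_)
open import Data.Nat as ℕ using (ℕ; zero; suc)
open import Data.Integer as ℤ using (ℤ; +_)
open import Data.List using (List; []; _∷_; _++_; [_]; map; concatMap; filter; foldr; sum; upTo)
open import Data.Product using (_×_; _,_)
open import Relation.Binary.PropositionalEquality using (_≡_; refl)
open import Relation.Nullary.Decidable using (does; _×-dec_)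
open import Data.List.Relation.Unary.Unique.DecPropositional ℕ._≟_ using (unique?)

data Kind : Set where
  X Y : Kind

-- a letter s_i^{ε}: positive = true means exponent +1, false means -1
record Letter : Set where
  constructor lt
  field
    kind     : Kind
    index    : ℕ
    positive : Bool
open Letter public

Word : Set
Word = List Letter

x₀ y₀ : Letter
x₀ = lt X 0 true
y₀ = lt Y 0 true

-- An element of 𝔼 = 𝕂[q][F(𝕊)] as a formal sum of terms  c · q^k · w
-- (c an integer coefficient, k ≥ 0, w a word of letters).
record Term : Set where
  constructor tm
  field
    coef : ℤ
    qpow : ℕ
    word : Word
open Term public

Elem : Set
Elem = List Term

upL : Letter → Letter
upL (lt k i p) = lt k (suc i) p

up : Word → Word
up = map upL

Rpos : Kind → ℕ → Elem
Rpos _ j = tm (+ 1) j (x₀ ∷ y₀ ∷ []) ∷ []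

R : Letter → Elem
R (lt k i true)  = Rpos k i
R (lt k i false) =
  map (λ t → tm (ℤ.- coef t) (qpow t)
                 (lt k i false ∷ word t ++ [ lt k (suc i) false ]))
      (Rpos k i)

-- LPO: stable sort by x₀ < x₁ < x₂ < ⋯ < y₀ < y₁ < ⋯
-- (the sign of a letter is ignored for the order)

_<L_ : Letter → Letter → Bool
lt X i _ <L lt X j _ = does (i ℕ.<? j)
lt X _ _ <L lt Y _ _ = true
lt Y _ _ <L lt X _ _ = false
lt Y i _ <L lt Y j _ = does (i ℕ.<? j)

insert : Letter → Word → Word
insert a []       = a ∷ []
insert a (b ∷ bs) = if b <L a then b ∷ insert a bs else a ∷ b ∷ bs

LPO : Word → Word
LPO = foldr insert []

splits : Word → List (Word × Letter × Word)
splits []       = []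
splits (a ∷ ws) = ([] , a , ws) ∷ map (λ { (p , b , s) → (a ∷ p , b , s) }) (splits ws)

Dword : Word → Elem
Dword w = concatMap
  (λ { (p , a , s) → map (λ t → tm (coef t) (qpow t) (LPO (p ++ word t ++ up s))) (R a) })
  (splits w)

D : Elem → Elem
D = concatMap (λ t → map (λ t' → tm (coef t ℤ.* coef t') (qpow t ℕ.+ qpow t') (word t')) (Dword (word t)))

Dⁿ : ℕ → Elem → Elem
Dⁿ zero    e = e
Dⁿ (suc n) e = D (Dⁿ n e)

-- Laurent polynomials in ℤ[q^{±1}, x^{±1}, y^{±1}] as formal sums of
-- monomials c · q^a x^b y^c, compared coefficientwise.

record Mono : Set where
  constructor mono
  field
    mcoef : ℤ
    qe xe ye : ℤ
open Mono public

Laurent : Set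
Laurent = List Mono

coeffOf : Laurent → ℤ → ℤ → ℤ → ℤ
coeffOf P a b c =
  foldr ℤ._+_ (+ 0)
    (map mcoef (filter (λ m → (qe m ℤ.≟ a) ×-dec ((xe m ℤ.≟ b) ×-dec (ye m ℤ.≟ c))) P))

_≈L_ : Laurent → Laurent → Set
P ≈L Q = ∀ a b c → coeffOf P a b c ≡ coeffOf Q a b c


φletter : Letter → ℤ × ℤ × ℤ   -- exponents of (q, x, y)
φletter (lt X j true)  = (+ j , + 1 , + 0)
φletter (lt Y j true)  = (+ j , + 0 , + 1)
φletter (lt X j false) = (ℤ.- (+ j) , ℤ.- (+ 1) , + 0)
φletter (lt Y j false) = (ℤ.- (+ j) , + 0 , ℤ.- (+ 1))

φword : Word → ℤ × ℤ × ℤ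
φword = foldr (λ a acc → add (φletter a) acc) (+ 0 , + 0 , + 0)
  where
  add : ℤ × ℤ × ℤ → ℤ × ℤ × ℤ → ℤ × ℤ × ℤ
  add (a , b , c) (a' , b' , c') = (a ℤ.+ a' , b ℤ.+ b' , c ℤ.+ c')

φ : Elem → Laurent
φ = map (λ t → φterm (coef t) (qpow t) (φword (word t)))
  where
  φterm : ℤ → ℕ → ℤ × ℤ × ℤ → Mono
  φterm c k (a , b , e) = mono c (+ k ℤ.+ a) b e

-- Permutations of [n] = {1,…,n}, written in one-line notation σ₁⋯σₙ:
-- all length-n sequences over {1,…,n} with pairwise distinct entries.

seqs : ℕ → ℕ → List (List ℕ)
seqs zero    n = [] ∷ []
seqs (suc k) n = concatMap (λ i → map (suc i ∷_) (seqs k n)) (upTo n)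

𝔖 : ℕ → List (List ℕ)
𝔖 n = filter unique? (seqs n n)

-- statistics, with σ₀ = σ_{n+1} = 0
pairs : List ℕ → List (ℕ × ℕ)
pairs []           = []
pairs (a ∷ [])     = []
pairs (a ∷ b ∷ bs) = (a , b) ∷ pairs (b ∷ bs)

padded : List ℕ → List ℕ
padded σ = 0 ∷ σ ++ [ 0 ]

count : (ℕ → ℕ → Bool) → List (ℕ × ℕ) → ℕ
count f = foldr (λ { (a , b) acc → if f a b then suc acc else acc }) 0

des asc : List ℕ → ℕ
des σ = count (λ a b → does (b ℕ.<? a)) (pairs (padded σ))
asc σ = count (λ a b → does (a ℕ.<? b)) (pairs (padded σ))

majFrom : ℕ → List ℕ → ℕ            -- first argument: position of head
majFrom i []           = 0
majFrom i (a ∷ [])     = 0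
majFrom i (a ∷ b ∷ bs) = (if does (b ℕ.<? a) then i else 0) ℕ.+ majFrom (suc i) (b ∷ bs)

maj : List ℕ → ℕ
maj = majFrom 1

Amaj : ℕ → Laurent
Amaj n = map (λ σ → mono (+ 1) (+ maj σ) (+ asc σ) (+ des σ)) (𝔖 n)

-- Every term of Dⁿ x₀ has coefficient 1 and a
-- positive word whose x-letters precede its y-letters (LPO sorts them), so the weights of its
-- derivative terms depend only on its own weight: differentiating a letter that has k letters to
-- its right replaces it by x₀y₀ and multiplies by q^k, since ↑ raises those k letters.  In a word
-- x…xy…y the y's thus give k = 0, …, b−1 and the x's give k = b, …, a+b−1 (children).
-- Inserting n+1 into the slots of a permutation of [n] acts on (maj, asc, des) by the same rule:
-- on the descent word of 0σ0 it replaces the letter of the slot by an ascent followed by a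
-- descent, so the descent slots raise maj by 0, …, des−1 and the ascent slots by des, …, n.
-- Hence the weights of Dⁿ x₀ and the statistics of 𝔖ₙ form the same multiset, and equal
-- multisets of monomials have equal coefficients.

module Submission where

open import Defs

open import Data.Nat as ℕ using (ℕ; zero; suc; _+_; _*_; _<_; _≤_; _≥_; _<?_; z≤n; s≤s; z<s)
import Data.Nat.Properties as ℕ
open import Data.Nat.Tactic.RingSolver using (solve-∀)
open import Data.Bool using (Bool; true; false; if_then_else_)
open import Data.Empty using (⊥-elim)
open import Data.Integer as ℤ using (ℤ; +_)
import Data.Integer.Properties as ℤ
open import Data.Product using (_×_; _,_; proj₁; proj₂; ∃₂)
open import Data.List
  using (List; []; _∷_; _++_; [_]; map; concatMap; foldr; filter; length; upTo; downFrom; applyDownFrom)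
open import Data.List.Properties
  using ( map-++; map-∘; map-cong; map-cong-local; map-injective; concatMap-cong; concatMap-map
        ; map-concatMap; map-downFrom; applyDownFrom-∷ʳ; ++-assoc; ∷-injectiveˡ; ∷-injectiveʳ
        ; filter-accept; filter-reject; filter-all)
open import Data.List.Membership.Propositional using (_∈_; find; lose)
open import Data.List.Membership.Propositional.Properties
  using ( ∈-map⁺; ∈-map⁻; ∈-concatMap⁺; ∈-concatMap⁻; ∈-upTo⁺; ∈-upTo⁻
        ; ∈-filter⁺; ∈-filter⁻; ∈-∃++)
open import Data.List.Membership.Propositional.Properties.WithK using (unique∧set⇒bag)
open import Data.List.Relation.Binary.BagAndSetEquality using (∼bag⇒↭)
open import Data.List.Relation.Binary.Permutation.Propositional
  using ( _↭_; ↭-refl; ↭-sym; ↭-trans; ↭-prep; ↭-swap; ↭-reflexive; ↭⇒↭ₛ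
        ; module PermutationReasoning)
open import Data.List.Relation.Binary.Permutation.Propositional.Properties
  using (shift; map⁺; ↭-map-inv; ↭-length; All-resp-↭; ++⁺; ++⁺ˡ; ++-comm; filter-↭)
open import Data.List.Relation.Unary.All as All using (All; []; _∷_)
import Data.List.Relation.Unary.All.Properties as All
open import Data.List.Relation.Unary.AllPairs using ([]; _∷_)
open import Data.List.Relation.Unary.Any using (here; there)
open import Data.List.Relation.Unary.Linked using (Linked; []; [-]; _∷_)
open import Data.List.Relation.Unary.Unique.Propositional using (Unique)
import Data.List.Relation.Unary.Unique.Propositional.Properties as Unique
open import Function using (_∘_; mk⇔)
open import Function.Definitions using (Injective)
open import Relation.Binary.PropositionalEquality as ≡
  using (_≡_; _≢_; refl; sym; trans; cong; cong₂; subst; ≢-sym; module ≡-Reasoning)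
open import Relation.Nullary using (Dec; does; yes; no; ¬_; ¬?)
open import Relation.Nullary.Decidable using (dec-true; dec-false)

open import Algebra.Properties.CommutativeSemigroup ℕ.+-commutativeSemigroup using (x∙yz≈y∙xz)
open import Data.List.Membership.DecPropositional ℕ._≟_ using (_∈?_)
open import Data.List.Relation.Unary.Unique.DecPropositional ℕ._≟_ using (unique?)
open import Data.List.Relation.Binary.Permutation.Setoid.Properties (≡.setoid ℕ) using (Unique-resp-↭)
open import Data.List.Relation.Binary.Permutation.Setoid.Properties (≡.setoid ℤ) using (foldr-commMonoid)

map-fuse : ∀ {A B C : Set} {g : B → C} {f : A → B} {h : A → C} →
           (∀ x → g (f x) ≡ h x) → ∀ xs → map g (map f xs) ≡ map h xs
map-fuse eq xs = trans (sym (map-∘ xs)) (map-cong eq xs)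

map-downFrom-suc : ∀ {A : Set} (f : ℕ → A) n →
                   map f (downFrom (suc n)) ≡ map (f ∘ suc) (downFrom n) ++ [ f 0 ]
map-downFrom-suc f n = begin
  map f (downFrom (suc n))              ≡⟨ map-downFrom f (suc n) ⟩
  applyDownFrom f (suc n)               ≡⟨ applyDownFrom-∷ʳ f n ⟨
  applyDownFrom (f ∘ suc) n ++ [ f 0 ]  ≡⟨ cong (_++ [ f 0 ]) (map-downFrom (f ∘ suc) n) ⟨
  map (f ∘ suc) (downFrom n) ++ [ f 0 ] ∎
  where open ≡-Reasoning

move-head : ∀ {A : Set} {h h′ : A} {us us′ vs vs′} →
            h ≡ h′ → us ≡ us′ → vs ≡ vs′ → h ∷ us ++ vs ↭ us′ ++ h′ ∷ vs′
move-head {h = h} {us = us} {vs = vs} refl refl refl = ↭-sym (shift h us vs)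

concatMap⁺ : ∀ {A B : Set} (f : A → List B) {xs ys} → xs ↭ ys → concatMap f xs ↭ concatMap f ys
concatMap⁺ f _↭_.refl         = ↭-refl
concatMap⁺ f (_↭_.prep x p)   = ++⁺ˡ (f x) (concatMap⁺ f p)
concatMap⁺ f (_↭_.swap x y p) = ↭-trans (↭-reflexive (sym (++-assoc (f x) (f y) _)))
  (↭-trans (++⁺ (++-comm (f x) (f y)) (concatMap⁺ f p)) (↭-reflexive (++-assoc (f y) (f x) _)))
concatMap⁺ f (_↭_.trans p q)  = ↭-trans (concatMap⁺ f p) (concatMap⁺ f q)

concatMap-↭-local : ∀ {A B : Set} {f g : A → List B} {xs} →
                    All (λ x → f x ↭ g x) xs → concatMap f xs ↭ concatMap g xs
concatMap-↭-local []       = ↭-refl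
concatMap-↭-local (p ∷ ps) = ++⁺ p (concatMap-↭-local ps)

↭-map-cancel : ∀ {A B : Set} {f : A → B} {xs ys} →
               Injective _≡_ _≡_ f → map f xs ↭ map f ys → xs ↭ ys
↭-map-cancel {f = f} {xs} f-inj p with ys′ , eq , xs↭ys′ ← ↭-map-inv f p =
  subst (xs ↭_) (sym (map-injective f-inj eq)) xs↭ys′

module _ {A : Set} where

  insertions : A → List A → List (List A)
  insertions x []       = (x ∷ []) ∷ []
  insertions x (y ∷ ys) = (x ∷ y ∷ ys) ∷ map (y ∷_) (insertions x ys)

  insertions-↭ : ∀ x xs → All (_↭ x ∷ xs) (insertions x xs)
  insertions-↭ x []       = ↭-refl ∷ []
  insertions-↭ x (y ∷ ys) =
    ↭-refl ∷ All.map⁺ (All.map (λ p → ↭-trans (↭-prep y p) (↭-swap y x ↭-refl))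
                               (insertions-↭ x ys))

  ∈-insertions : ∀ x us vs → us ++ x ∷ vs ∈ insertions x (us ++ vs)
  ∈-insertions x []       []      = here refl
  ∈-insertions x []       (_ ∷ _) = here refl
  ∈-insertions x (u ∷ us) vs      = there (∈-map⁺ (u ∷_) (∈-insertions x us vs))

  unique-insertions : ∀ {x xs} → All (x ≢_) xs → Unique (insertions x xs)
  unique-insertions {xs = []}    []           = [] ∷ []
  unique-insertions {xs = _ ∷ _} (x≢y ∷ x∉ys) =
    All.map⁺ (All.universal (λ _ eq → x≢y (∷-injectiveˡ eq)) _)
    ∷ Unique.map⁺ ∷-injectiveʳ (unique-insertions x∉ys)

  unique-concatMap : ∀ {B : Set} {f : A → List B} (key : B → A) {xs} → Unique xs →
                     All (λ x → Unique (f x) × All (λ y → key y ≡ x) (f x)) xs →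
                     Unique (concatMap f xs)
  unique-concatMap key [] [] = []
  unique-concatMap {f = f} key {x ∷ xs} (x∉xs ∷ u) ((ux , kx) ∷ uks) =
    Unique.++⁺ ux (unique-concatMap key u uks) disjoint
    where
    disjoint : ∀ {v} → ¬ (v ∈ f x × v ∈ concatMap f xs)
    disjoint (v∈fx , v∈rest) with find (∈-concatMap⁻ f {xs = xs} v∈rest)
    ... | y , y∈xs , v∈fy = All.lookup x∉xs y∈xs
      (trans (sym (All.lookup kx v∈fx)) (All.lookup (proj₂ (All.lookup uks y∈xs)) v∈fy))

-- Weights

record Weight : Set where
  constructor ⟨_,_,_⟩
  field
    qExp xExp yExp : ℕ
open Weight

cong⟨,,⟩ : ∀ {s s′ a a′ b b′} → s ≡ s′ → a ≡ a′ → b ≡ b′ →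
           ⟨ s , a , b ⟩ ≡ ⟨ s′ , a′ , b′ ⟩
cong⟨,,⟩ refl refl refl = refl

shiftQ : ℕ → Weight → Weight
shiftQ n ⟨ s , a , b ⟩ = ⟨ n + s , a , b ⟩

shiftQ-injective : ∀ n → Injective _≡_ _≡_ (shiftQ n)
shiftQ-injective n eq = cong⟨,,⟩ (ℕ.+-cancelˡ-≡ n _ _ (cong qExp eq)) (cong xExp eq) (cong yExp eq)

bumpX bumpY raise : Weight → Weight
bumpX ⟨ s , a , b ⟩ = ⟨ s , suc a , b ⟩
bumpY ⟨ s , a , b ⟩ = ⟨ s , a , suc b ⟩
raise ⟨ s , a , b ⟩ = ⟨ a + b + s , a , b ⟩

xChild yChild : Weight → ℕ → Weight
xChild ⟨ s , a , b ⟩ k = ⟨ k + b + s , a , suc b ⟩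
yChild ⟨ s , a , b ⟩ k = ⟨ k + s , suc a , b ⟩

children : Weight → List Weight
children w = map (xChild w) (downFrom (xExp w)) ++ map (yChild w) (downFrom (yExp w))

generation : ℕ → List Weight
generation zero    = ⟨ 0 , 1 , 0 ⟩ ∷ []
generation (suc n) = concatMap children (generation n)

map-children : ∀ (f : Weight → Weight) w →
  map f (children w) ≡ map (f ∘ xChild w) (downFrom (xExp w)) ++ map (f ∘ yChild w) (downFrom (yExp w))
map-children f w =
  trans (map-++ f (map (xChild w) xs) (map (yChild w) ys)) (sym (cong₂ _++_ (map-∘ xs) (map-∘ ys)))
  where
  xs = downFrom (xExp w)
  ys = downFrom (yExp w)

children-shiftQ : ∀ n w → map (shiftQ n) (children w) ≡ children (shiftQ n w)
children-shiftQ n w@(⟨ s , a , b ⟩) = trans (map-children (shiftQ n) w) (cong₂ _++_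
  (map-cong (λ k → cong⟨,,⟩ (x∙yz≈y∙xz n (k + b) s) refl refl) (downFrom a))
  (map-cong (λ k → cong⟨,,⟩ (x∙yz≈y∙xz n k s) refl refl) (downFrom b)))

children-bumpX : ∀ w → children (bumpX w) ≡ bumpX (bumpY (raise w)) ∷ map bumpX (children w)
children-bumpX w = cong (bumpX (bumpY (raise w)) ∷_) (sym (map-children bumpX w))

children-bumpY : ∀ w → xExp w ≡ 0 →
                 children (bumpY w) ≡ bumpX (bumpY (raise w)) ∷ map bumpY (children w)
children-bumpY ⟨ s , _ , b ⟩ refl =
  cong (⟨ b + s , 1 , suc b ⟩ ∷_) (sym (map-children bumpY ⟨ s , 0 , b ⟩))

-- The q-derivative of sorted words

bump : Kind → Weight → Weight
bump X = bumpX
bump Y = bumpY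

addLetter : Letter → Weight → Weight
addLetter c = shiftQ (index c) ∘ bump (kind c)

addLetter-comm : ∀ c d w → addLetter c (addLetter d w) ≡ addLetter d (addLetter c w)
addLetter-comm (lt X i _) (lt X j _) w = cong⟨,,⟩ (x∙yz≈y∙xz i j (qExp w)) refl refl
addLetter-comm (lt X i _) (lt Y j _) w = cong⟨,,⟩ (x∙yz≈y∙xz i j (qExp w)) refl refl
addLetter-comm (lt Y i _) (lt X j _) w = cong⟨,,⟩ (x∙yz≈y∙xz i j (qExp w)) refl refl
addLetter-comm (lt Y i _) (lt Y j _) w = cong⟨,,⟩ (x∙yz≈y∙xz i j (qExp w)) refl refl

addLetter-shiftQ : ∀ c n w → addLetter c (shiftQ n w) ≡ shiftQ n (addLetter c w)
addLetter-shiftQ (lt X i _) n w = cong⟨,,⟩ (x∙yz≈y∙xz i n (qExp w)) refl refl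
addLetter-shiftQ (lt Y i _) n w = cong⟨,,⟩ (x∙yz≈y∙xz i n (qExp w)) refl refl

addLetter-raise : ∀ c w → addLetter (upL c) (raise w) ≡ raise (addLetter c w)
addLetter-raise (lt X i _) ⟨ s , a , b ⟩ = cong⟨,,⟩ (arith i s a b) refl refl
  where
  arith : ∀ i s a b → suc i + (a + b + s) ≡ suc a + b + (i + s)
  arith = solve-∀
addLetter-raise (lt Y i _) ⟨ s , a , b ⟩ = cong⟨,,⟩ (arith i s a b) refl refl
  where
  arith : ∀ i s a b → suc i + (a + b + s) ≡ a + suc b + (i + s)
  arith = solve-∀

wordWeight : Word → Weight
wordWeight = foldr addLetter ⟨ 0 , 0 , 0 ⟩

wordWeight-↭ : ∀ {v w} → v ↭ w → wordWeight v ≡ wordWeight w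
wordWeight-↭ _↭_.refl         = refl
wordWeight-↭ (_↭_.prep c p)   = cong (addLetter c) (wordWeight-↭ p)
wordWeight-↭ (_↭_.swap c d p) =
  trans (addLetter-comm c d _) (cong (addLetter d ∘ addLetter c) (wordWeight-↭ p))
wordWeight-↭ (_↭_.trans p q)  = trans (wordWeight-↭ p) (wordWeight-↭ q)

wordWeight-up : ∀ w → wordWeight (up w) ≡ raise (wordWeight w)
wordWeight-up []      = refl
wordWeight-up (c ∷ w) =
  trans (cong (addLetter (upL c)) (wordWeight-up w)) (addLetter-raise c (wordWeight w))

insert-↭ : ∀ c w → insert c w ↭ c ∷ w
insert-↭ c [] = ↭-refl
insert-↭ c (d ∷ w) with d <L c
... | true  = ↭-trans (↭-prep d (insert-↭ c w)) (↭-swap d c ↭-refl)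
... | false = ↭-refl

LPO-↭ : ∀ w → LPO w ↭ w
LPO-↭ []      = ↭-refl
LPO-↭ (c ∷ w) = ↭-trans (insert-↭ c (LPO w)) (↭-prep c (LPO-↭ w))

Positive : Word → Set
Positive = All (λ c → positive c ≡ true)

data Ys : Word → Set where
  []  : Ys []
  y∷_ : ∀ {i w} → Ys w → Ys (lt Y i true ∷ w)

data XsThenYs : Word → Set where
  yblock : ∀ {w} → Ys w → XsThenYs w
  x∷_    : ∀ {i w} → XsThenYs w → XsThenYs (lt X i true ∷ w)

Ys-positive : ∀ {w} → Ys w → Positive w
Ys-positive []     = []
Ys-positive (y∷ w) = refl ∷ Ys-positive w

XsThenYs-positive : ∀ {w} → XsThenYs w → Positive w
XsThenYs-positive (yblock w) = Ys-positive w
XsThenYs-positive (x∷ w)     = refl ∷ XsThenYs-positive w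

Ys-xExp : ∀ {w} → Ys w → xExp (wordWeight w) ≡ 0
Ys-xExp []     = refl
Ys-xExp (y∷ w) = Ys-xExp w

insert-Ys : ∀ i {w} → Ys w → Ys (insert (lt Y i true) w)
insert-Ys i [] = y∷ []
insert-Ys i (y∷_ {j} w) with does (j ℕ.<? i)
... | true  = y∷ insert-Ys i w
... | false = y∷ y∷ w

insert-XsThenYs : ∀ {c w} → positive c ≡ true → XsThenYs w → XsThenYs (insert c w)
insert-XsThenYs {lt Y i _} refl (yblock w)      = yblock (insert-Ys i w)
insert-XsThenYs {lt Y i _} refl (x∷ w)          = x∷ insert-XsThenYs refl w
insert-XsThenYs {lt X i _} refl (yblock [])     = x∷ yblock []
insert-XsThenYs {lt X i _} refl (yblock (y∷ w)) = x∷ yblock (y∷ w)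
insert-XsThenYs {lt X i _} refl (x∷_ {j} w) with does (j ℕ.<? i)
... | true  = x∷ insert-XsThenYs refl w
... | false = x∷ x∷ w

LPO-XsThenYs : ∀ {w} → Positive w → XsThenYs (LPO w)
LPO-XsThenYs []       = yblock []
LPO-XsThenYs (p ∷ ps) = insert-XsThenYs p (LPO-XsThenYs ps)

weight : Term → Weight
weight t = shiftQ (qpow t) (wordWeight (word t))

insertLetter : Letter → Term → Term
insertLetter c t = tm (coef t) (qpow t) (insert c (word t))

derivTerms : Word × Letter × Word → Elem
derivTerms (p , c , s) = map (λ t → tm (coef t) (qpow t) (LPO (p ++ word t ++ up s))) (R c)

Dword-splits : ∀ w → Dword w ≡ concatMap derivTerms (splits w)
Dword-splits w = concatMap-cong (λ _ → refl) (splits w)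

prependSplit : Letter → Word × Letter × Word → Word × Letter × Word
prependSplit c (p , d , s) = (c ∷ p , d , s)

splits-∷ : ∀ c w → splits (c ∷ w) ≡ ([] , c , w) ∷ map (prependSplit c) (splits w)
splits-∷ c w = cong (([] , c , w) ∷_) (map-cong (λ _ → refl) (splits w))

concatMap-derivTerms-prependSplit : ∀ c ss →
  concatMap derivTerms (map (prependSplit c) ss) ≡ map (insertLetter c) (concatMap derivTerms ss)
concatMap-derivTerms-prependSplit c ss = begin
  concatMap derivTerms (map (prependSplit c) ss)   ≡⟨ concatMap-map derivTerms (prependSplit c) ss ⟩
  concatMap (derivTerms ∘ prependSplit c) ss       ≡⟨ concatMap-cong (λ (_ , d , _) → map-∘ (R d)) ss ⟩
  concatMap (map (insertLetter c) ∘ derivTerms) ss ≡⟨ map-concatMap (insertLetter c) derivTerms ss ⟨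
  map (insertLetter c) (concatMap derivTerms ss)   ∎
  where open ≡-Reasoning

Dword-∷ : ∀ c w → Dword (c ∷ w) ≡ derivTerms ([] , c , w) ++ map (insertLetter c) (Dword w)
Dword-∷ c w = begin
  Dword (c ∷ w)                          ≡⟨ Dword-splits (c ∷ w) ⟩
  concatMap derivTerms (splits (c ∷ w))  ≡⟨ cong (concatMap derivTerms) (splits-∷ c w) ⟩
  derivTerms ([] , c , w) ++ concatMap derivTerms (map (prependSplit c) (splits w))
    ≡⟨ cong (derivTerms ([] , c , w) ++_) (concatMap-derivTerms-prependSplit c (splits w)) ⟩
  derivTerms ([] , c , w) ++ map (insertLetter c) (concatMap derivTerms (splits w))
    ≡⟨ cong (λ ts → derivTerms ([] , c , w) ++ map (insertLetter c) ts) (Dword-splits w) ⟨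
  derivTerms ([] , c , w) ++ map (insertLetter c) (Dword w) ∎
  where open ≡-Reasoning

weight-insertLetter : ∀ c t → weight (insertLetter c t) ≡ addLetter c (weight t)
weight-insertLetter c t = trans (cong (shiftQ (qpow t)) (wordWeight-↭ (insert-↭ c (word t))))
                                (sym (addLetter-shiftQ c (qpow t) (wordWeight (word t))))

weights-Dword-∷ : ∀ k i w → let c = lt k i true ; W = wordWeight w in
  map weight (Dword w) ≡ children W →
  children (bump k W) ≡ bumpX (bumpY (raise W)) ∷ map (bump k) (children W) →
  map weight (Dword (c ∷ w)) ≡ children (wordWeight (c ∷ w))
weights-Dword-∷ k i w ih split = begin
  map weight (Dword (c ∷ w))
    ≡⟨ cong (map weight) (Dword-∷ c w) ⟩
  weight (tm (+ 1) i (LPO (x₀ ∷ y₀ ∷ up w))) ∷ map weight (map (insertLetter c) (Dword w))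
    ≡⟨ cong₂ _∷_ (cong (shiftQ i) head) (map-fuse (weight-insertLetter c) (Dword w)) ⟩
  shiftQ i H ∷ map (addLetter c ∘ weight) (Dword w)
    ≡⟨ cong (shiftQ i H ∷_) (trans (map-∘ (Dword w)) (map-∘ (map weight (Dword w)))) ⟩
  map (shiftQ i) (H ∷ map (bump k) (map weight (Dword w)))
    ≡⟨ cong (λ ws → map (shiftQ i) (H ∷ map (bump k) ws)) ih ⟩
  map (shiftQ i) (H ∷ map (bump k) (children W))
    ≡⟨ cong (map (shiftQ i)) split ⟨
  map (shiftQ i) (children (bump k W))
    ≡⟨ children-shiftQ i (bump k W) ⟩
  children (wordWeight (c ∷ w)) ∎
  where
  open ≡-Reasoning
  c = lt k i true
  W = wordWeight w
  H = bumpX (bumpY (raise W))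
  head : wordWeight (LPO (x₀ ∷ y₀ ∷ up w)) ≡ H
  head = trans (wordWeight-↭ (LPO-↭ (x₀ ∷ y₀ ∷ up w))) (cong (bumpX ∘ bumpY) (wordWeight-up w))

weights-Dword : ∀ {w} → XsThenYs w → map weight (Dword w) ≡ children (wordWeight w)
weights-Dword (yblock []) = refl
weights-Dword (yblock (y∷_ {i} {w} w′)) =
  weights-Dword-∷ Y i w (weights-Dword (yblock w′)) (children-bumpY _ (Ys-xExp w′))
weights-Dword (x∷_ {i} {w} w′) =
  weights-Dword-∷ X i w (weights-Dword w′) (children-bumpX _)

Canonical : Term → Set
Canonical t = coef t ≡ + 1 × XsThenYs (word t)

Canonical-Dword : ∀ {w} → Positive w → All Canonical (Dword w)
Canonical-Dword [] = []
Canonical-Dword {lt k i _ ∷ w} (refl ∷ ps) = subst (All Canonical) (sym (Dword-∷ (lt k i true) w))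
  ((refl , LPO-XsThenYs (refl ∷ refl ∷ All.map⁺ ps))
   ∷ All.map⁺ (All.map (λ (e , s) → e , insert-XsThenYs refl s) (Canonical-Dword ps)))

scaleBy : Term → Term → Term
scaleBy t t′ = tm (coef t ℤ.* coef t′) (qpow t + qpow t′) (word t′)

Canonical-D : ∀ {E} → All Canonical E → All Canonical (D E)
Canonical-D [] = []
Canonical-D ((e , s) ∷ cs) = All.++⁺
  (All.map⁺ (All.map (λ (e′ , s′) → cong₂ ℤ._*_ e e′ , s′)
                      (Canonical-Dword (XsThenYs-positive s))))
  (Canonical-D cs)

weights-D : ∀ {E} → All Canonical E → map weight (D E) ≡ concatMap children (map weight E)
weights-D [] = refl
weights-D {t ∷ E} ((_ , s) ∷ cs) = begin
  map weight (Ds ++ D E)              ≡⟨ map-++ weight Ds (D E) ⟩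
  map weight Ds ++ map weight (D E)   ≡⟨ cong₂ _++_ scaled (weights-D cs) ⟩
  children (weight t) ++ concatMap children (map weight E) ∎
  where
  open ≡-Reasoning
  Ds = map (scaleBy t) (Dword (word t))
  scaled : map weight Ds ≡ children (weight t)
  scaled = begin
    map weight Ds
      ≡⟨ map-fuse (λ t′ → cong⟨,,⟩ (ℕ.+-assoc (qpow t) (qpow t′) _) refl refl) (Dword (word t)) ⟩
    map (shiftQ (qpow t) ∘ weight) (Dword (word t))
      ≡⟨ map-∘ (Dword (word t)) ⟩
    map (shiftQ (qpow t)) (map weight (Dword (word t)))
      ≡⟨ cong (map (shiftQ (qpow t))) (weights-Dword s) ⟩
    map (shiftQ (qpow t)) (children (wordWeight (word t)))
      ≡⟨ children-shiftQ (qpow t) (wordWeight (word t)) ⟩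
    children (weight t) ∎

seed : Elem
seed = tm (+ 1) 0 (x₀ ∷ []) ∷ []

Canonical-Dⁿ : ∀ n → All Canonical (Dⁿ n seed)
Canonical-Dⁿ zero    = (refl , x∷ yblock []) ∷ []
Canonical-Dⁿ (suc n) = Canonical-D (Canonical-Dⁿ n)

weights-Dⁿ : ∀ n → map weight (Dⁿ n seed) ≡ generation n
weights-Dⁿ zero    = refl
weights-Dⁿ (suc n) = trans (weights-D (Canonical-Dⁿ n)) (cong (concatMap children) (weights-Dⁿ n))

toMono : Weight → Mono
toMono ⟨ s , a , b ⟩ = mono (+ 1) (+ s) (+ a) (+ b)

φword-positive : ∀ {w} → Positive w →
                 φword w ≡ (+ qExp (wordWeight w) , + xExp (wordWeight w) , + yExp (wordWeight w))
φword-positive [] = refl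
φword-positive {lt X _ _ ∷ _} (refl ∷ ps) rewrite φword-positive ps = refl
φword-positive {lt Y _ _ ∷ _} (refl ∷ ps) rewrite φword-positive ps = refl

φ-canonical : ∀ {E} → All Canonical E → φ E ≡ map toMono (map weight E)
φ-canonical [] = refl
φ-canonical {tm _ _ _ ∷ _} ((refl , s) ∷ cs) rewrite φword-positive (XsThenYs-positive s) =
  cong (_ ∷_) (φ-canonical cs)

-- Permutations as insertions of the maximum

InRange : ℕ → ℕ → Set
InRange n x = 0 < x × x ≤ n

record IsPermutation (n : ℕ) (τ : List ℕ) : Set where
  field
    length≡ : length τ ≡ n
    inRange : All (InRange n) τ
    unique  : Unique τ
open IsPermutation

∈-seqs⁻ : ∀ k n {τ} → τ ∈ seqs k n → length τ ≡ k × All (InRange n) τ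
∈-seqs⁻ zero    n (here refl) = refl , []
∈-seqs⁻ (suc k) n τ∈ with find (∈-concatMap⁻ (λ i → map (suc i ∷_) (seqs k n)) {xs = upTo n} τ∈)
... | i , i∈ , τ∈′ with ∈-map⁻ (suc i ∷_) τ∈′
... | τ′ , τ′∈ , refl with ∈-seqs⁻ k n τ′∈
... | l , b = cong suc l , (z<s , ∈-upTo⁻ i∈) ∷ b

∈-seqs⁺ : ∀ k n {τ} → length τ ≡ k → All (InRange n) τ → τ ∈ seqs k n
∈-seqs⁺ zero    n {[]}        refl []             = here refl
∈-seqs⁺ (suc k) n {suc i ∷ τ} l    ((_ , i<n) ∷ b) = ∈-concatMap⁺ (λ i → map (suc i ∷_) (seqs k n))
  (lose (∈-upTo⁺ i<n) (∈-map⁺ (suc i ∷_) (∈-seqs⁺ k n (ℕ.suc-injective l) b)))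

unique-seqs : ∀ k n → Unique (seqs k n)
unique-seqs zero    n = [] ∷ []
unique-seqs (suc k) n = unique-concatMap headPred (Unique.upTo⁺ n) (All.universal (λ i →
  Unique.map⁺ ∷-injectiveʳ (unique-seqs k n) , All.map⁺ (All.universal (λ _ → refl) _)) (upTo n))
  where
  headPred : List ℕ → ℕ
  headPred []      = 0
  headPred (x ∷ _) = ℕ.pred x

𝔖-sound : ∀ {n τ} → τ ∈ 𝔖 n → IsPermutation n τ
𝔖-sound {n} τ∈ with ∈-filter⁻ unique? {xs = seqs n n} τ∈
... | τ∈′ , u with ∈-seqs⁻ n n τ∈′
... | l , b = record { length≡ = l ; inRange = b ; unique = u }

𝔖-complete : ∀ {n τ} → IsPermutation n τ → τ ∈ 𝔖 n
𝔖-complete {n} p = ∈-filter⁺ unique? (∈-seqs⁺ n n (length≡ p) (inRange p)) (unique p)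

unique-𝔖 : ∀ n → Unique (𝔖 n)
unique-𝔖 n = Unique.filter⁺ unique? (unique-seqs n n)

erase : ℕ → List ℕ → List ℕ
erase m = filter (λ y → ¬? (y ℕ.≟ m))

erase-insertions : ∀ {m σ} → All (m ≢_) σ → All (λ τ → erase m τ ≡ σ) (insertions m σ)
erase-insertions {m} {[]} [] = filter-reject P? (λ m≢m → m≢m refl) ∷ []
  where P? = λ y → ¬? (y ℕ.≟ m)
erase-insertions {m} {a ∷ σ} (m≢a ∷ m∉σ) =
  trans (filter-reject P? (λ m≢m → m≢m refl)) (filter-all P? (All.map (_∘ sym) (m≢a ∷ m∉σ)))
  ∷ All.map⁺ (All.map (λ eq → trans (filter-accept P? (m≢a ∘ sym)) (cong (a ∷_) eq))
                      (erase-insertions m∉σ))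
  where P? = λ y → ¬? (y ℕ.≟ m)

shrink : ∀ {n xs} → All (InRange (suc n)) xs → All (suc n ≢_) xs → All (InRange n) xs
shrink b n∉ = All.zipWith (λ ((0<x , x≤) , n≢x) → 0<x , ℕ.≤-pred (ℕ.≤∧≢⇒< x≤ (≢-sym n≢x)))
                          (b , n∉)

fresh : ∀ {n xs} → All (InRange n) xs → All (suc n ≢_) xs
fresh = All.map (λ (_ , x≤n) → ℕ.>⇒≢ (s≤s x≤n))

split-at-max : ∀ {n τ} → suc n ∈ τ → Unique τ → All (InRange (suc n)) τ →
               ∃₂ λ us vs → τ ≡ us ++ suc n ∷ vs × Unique (us ++ vs) × All (InRange n) (us ++ vs)
split-at-max m∈τ u b with ∈-∃++ m∈τ
... | us , vs , refl with Unique-resp-↭ (↭⇒↭ₛ (shift _ us vs)) u | All-resp-↭ (shift _ us vs) b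
... | m∉ ∷ u′ | _ ∷ b′ = us , vs , refl , u′ , shrink b′ m∉

unique-bounded-length : ∀ n {τ} → Unique τ → All (InRange n) τ → length τ ≤ n
unique-bounded-length zero    {[]}    _ _                 = z≤n
unique-bounded-length zero    {_ ∷ _} _ ((0<x , x≤0) ∷ _) = ⊥-elim (ℕ.<⇒≱ 0<x x≤0)
unique-bounded-length (suc n) {τ} u b with suc n ∈? τ
... | no m∉τ = ℕ.m≤n⇒m≤1+n (unique-bounded-length n u (shrink b (All.¬Any⇒All¬ τ m∉τ)))
... | yes m∈τ with split-at-max m∈τ u b
... | us , vs , refl , u′ , b′ =
  subst (_≤ suc n) (sym (↭-length (shift (suc n) us vs))) (s≤s (unique-bounded-length n u′ b′))

max-∈ : ∀ {n τ} → IsPermutation (suc n) τ → suc n ∈ τ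
max-∈ {n} {τ} p with suc n ∈? τ
... | yes m∈τ = m∈τ
... | no m∉τ  = ⊥-elim (ℕ.n≮n n (subst (_≤ n) (length≡ p)
  (unique-bounded-length n (unique p) (shrink (inRange p) (All.¬Any⇒All¬ τ m∉τ)))))

insertion-IsPermutation : ∀ {n σ τ} → IsPermutation n σ → τ ∈ insertions (suc n) σ →
                          IsPermutation (suc n) τ
insertion-IsPermutation {n} {σ} p τ∈ = record
  { length≡ = trans (↭-length τ↭) (cong suc (length≡ p))
  ; inRange = All-resp-↭ (↭-sym τ↭) ((z<s , ℕ.≤-refl) ∷ All.map weaken (inRange p))
  ; unique  = Unique-resp-↭ (↭⇒↭ₛ (↭-sym τ↭)) (fresh (inRange p) ∷ unique p)
  }
  where
  τ↭ = All.lookup (insertions-↭ (suc n) σ) τ∈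
  weaken : ∀ {x} → InRange n x → InRange (suc n) x
  weaken (0<x , x≤n) = 0<x , ℕ.m≤n⇒m≤1+n x≤n

𝔖-suc : ∀ n → 𝔖 (suc n) ↭ concatMap (insertions (suc n)) (𝔖 n)
𝔖-suc n = ∼bag⇒↭ (unique∧set⇒bag (unique-𝔖 (suc n)) unique-insertions-𝔖 (mk⇔ to from))
  where
  unique-insertions-𝔖 : Unique (concatMap (insertions (suc n)) (𝔖 n))
  unique-insertions-𝔖 = unique-concatMap (erase (suc n)) (unique-𝔖 n) (All.tabulate λ σ∈ →
    let m∉σ = fresh (inRange (𝔖-sound σ∈)) in unique-insertions m∉σ , erase-insertions m∉σ)
  to : ∀ {τ} → τ ∈ 𝔖 (suc n) → τ ∈ concatMap (insertions (suc n)) (𝔖 n)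
  to τ∈ with p ← 𝔖-sound τ∈ with split-at-max {n} (max-∈ p) (unique p) (inRange p)
  ... | us , vs , refl , u′ , b′ =
    ∈-concatMap⁺ (insertions (suc n)) (lose (𝔖-complete σ-perm) (∈-insertions (suc n) us vs))
    where
    σ-perm : IsPermutation n (us ++ vs)
    σ-perm = record
      { length≡ = ℕ.suc-injective (trans (sym (↭-length (shift (suc n) us vs))) (length≡ p))
      ; inRange = b′
      ; unique  = u′
      }
  from : ∀ {τ} → τ ∈ concatMap (insertions (suc n)) (𝔖 n) → τ ∈ 𝔖 (suc n)
  from τ∈ with σ , σ∈ , τ∈σ ← find (∈-concatMap⁻ (insertions (suc n)) {xs = 𝔖 n} τ∈) =
    𝔖-complete (insertion-IsPermutation (𝔖-sound σ∈) τ∈σ)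

-- Descent words

trues falses : List Bool → ℕ
trues []      = 0
trues (c ∷ e) = if c then suc (trues e) else trues e
falses []      = 0
falses (c ∷ e) = if c then falses e else suc (falses e)

-- majᵇ e sums the positions, counted from 0, of the letters true in e.
majᵇ : List Bool → ℕ
majᵇ []      = 0
majᵇ (_ ∷ e) = trues e + majᵇ e

statᵇ : List Bool → Weight
statᵇ e = ⟨ majᵇ e , falses e , trues e ⟩

-- Chosen so that statᵇ (c ∷ e) = consStat c (statᵇ e) holds definitionally.
consStat : Bool → Weight → Weight
consStat c ⟨ m , f , t ⟩ = ⟨ t + m , (if c then f else suc f) , (if c then suc t else t) ⟩

peakInsertions : List Bool → List (List Bool)
peakInsertions []      = []
peakInsertions (c ∷ e) = (false ∷ true ∷ e) ∷ map (c ∷_) (peakInsertions e)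

children-peak : ∀ c w → consStat false (consStat true w) ∷ map (consStat c) (children (shiftQ 1 w))
                        ↭ children (shiftQ 1 (consStat c w))
children-peak true w@(⟨ m , f , t ⟩) = ↭-trans
  (↭-reflexive (cong (consStat false (consStat true w) ∷_) (map-children (consStat true) (shiftQ 1 w))))
  (move-head (cong⟨,,⟩ (arithₕ t m) refl refl)
             (map-cong (λ k → cong⟨,,⟩ (arithₓ k t m) refl refl) (downFrom f))
             (map-cong (λ k → cong⟨,,⟩ (arithᵧ k t m) refl refl) (downFrom t)))
  where
  arithₕ : ∀ t m → suc t + (t + m) ≡ t + suc (t + m)
  arithₕ = solve-∀
  arithₓ : ∀ k t m → suc t + (k + t + suc m) ≡ k + suc t + suc (t + m)
  arithₓ = solve-∀
  arithᵧ : ∀ k t m → t + (k + suc m) ≡ k + suc (t + m)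
  arithᵧ = solve-∀
children-peak false w@(⟨ m , f , t ⟩) = ↭-trans
  (↭-reflexive (cong (consStat false (consStat true w) ∷_) (map-children (consStat false) (shiftQ 1 w))))
  (↭-trans
    (move-head (cong⟨,,⟩ (arithₕ t m) refl refl)
               (map-cong (λ k → cong⟨,,⟩ (arithₓ k t m) refl refl) (downFrom f))
               (map-cong (λ k → cong⟨,,⟩ (arithᵧ k t m) refl refl) (downFrom t)))
    (↭-reflexive (trans (sym (++-assoc (map (xChild w′ ∘ suc) (downFrom f)) [ xChild w′ 0 ] ys))
                        (cong (_++ ys) (sym (map-downFrom-suc (xChild w′) f))))))
  where
  w′ = ⟨ suc (t + m) , suc f , t ⟩
  ys = map (yChild w′) (downFrom t)
  arithₕ : ∀ t m → suc t + (t + m) ≡ 0 + t + suc (t + m)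
  arithₕ = solve-∀
  arithₓ : ∀ k t m → suc t + (k + t + suc m) ≡ suc k + t + suc (t + m)
  arithₓ = solve-∀
  arithᵧ : ∀ k t m → t + (k + suc m) ≡ k + suc (t + m)
  arithᵧ = solve-∀

statᵇ-peakInsertions : ∀ e → map statᵇ (peakInsertions e) ↭ children (shiftQ 1 (statᵇ e))
statᵇ-peakInsertions []      = ↭-refl
statᵇ-peakInsertions (c ∷ e) = begin
  statᵇ (false ∷ true ∷ e) ∷ map statᵇ (map (c ∷_) (peakInsertions e))
    ≡⟨ cong (statᵇ (false ∷ true ∷ e) ∷_) (map-fuse (λ _ → refl) (peakInsertions e)) ⟩
  statᵇ (false ∷ true ∷ e) ∷ map (consStat c ∘ statᵇ) (peakInsertions e)
    ≡⟨ cong (statᵇ (false ∷ true ∷ e) ∷_) (map-∘ (peakInsertions e)) ⟩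
  statᵇ (false ∷ true ∷ e) ∷ map (consStat c) (map statᵇ (peakInsertions e))
    ↭⟨ ↭-prep _ (map⁺ (consStat c) (statᵇ-peakInsertions e)) ⟩
  statᵇ (false ∷ true ∷ e) ∷ map (consStat c) (children (shiftQ 1 (statᵇ e)))
    ↭⟨ children-peak c (statᵇ e) ⟩
  children (shiftQ 1 (statᵇ (c ∷ e))) ∎
  where open PermutationReasoning

isDescent : ℕ × ℕ → Bool
isDescent (a , b) = does (b <? a)

descentWord : List ℕ → List Bool
descentWord l = map isDescent (pairs l)

stat : List ℕ → Weight
stat σ = ⟨ maj σ , asc σ , des σ ⟩

trues-descentWord : ∀ l → trues (descentWord l) ≡ count (λ a b → does (b <? a)) (pairs l)
trues-descentWord l = go (pairs l)
  where
  go : ∀ ps → trues (map isDescent ps) ≡ count (λ a b → does (b <? a)) ps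
  go []       = refl
  go (p ∷ ps) = cong (λ n → if isDescent p then suc n else n) (go ps)

if-does : ∀ {P Q : Set} (p? : Dec P) (q? : Dec Q) (n : ℕ) → (P → ¬ Q) → (¬ P → Q) →
          (if does p? then n else suc n) ≡ (if does q? then suc n else n)
if-does (yes p) (yes q) _ p⇒¬q _    = ⊥-elim (p⇒¬q p q)
if-does (yes _) (no _)  _ _    _    = refl
if-does (no _)  (yes _) _ _    _    = refl
if-does (no ¬p) (no ¬q) _ _    ¬p⇒q = ⊥-elim (¬q (¬p⇒q ¬p))

non-descent-is-ascent : ∀ {a b} (n : ℕ) → a ≢ b →
  (if does (b <? a) then n else suc n) ≡ (if does (a <? b) then suc n else n)
non-descent-is-ascent {a} {b} n a≢b =
  if-does (b <? a) (a <? b) n (λ b<a a<b → ℕ.<-asym a<b b<a)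
                              (λ b≮a → ℕ.≤∧≢⇒< (ℕ.≮⇒≥ b≮a) a≢b)

falses-descentWord : ∀ {l} → Linked _≢_ l →
                     falses (descentWord l) ≡ count (λ a b → does (a <? b)) (pairs l)
falses-descentWord []  = refl
falses-descentWord [-] = refl
falses-descentWord {a ∷ b ∷ _} (a≢b ∷ l) =
  trans (cong (λ n → if does (b <? a) then n else suc n) (falses-descentWord l))
        (non-descent-is-ascent _ a≢b)

majFrom-descentWord : ∀ i l → majFrom i l ≡ trues (descentWord l) * i + majᵇ (descentWord l)
majFrom-descentWord i []          = refl
majFrom-descentWord i (a ∷ [])    = refl
majFrom-descentWord i (a ∷ b ∷ r) = trans
  (cong (_+_ (if does (b <? a) then i else 0)) (majFrom-descentWord (suc i) (b ∷ r)))
  (step (does (b <? a)))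
  where
  T = trues (descentWord (b ∷ r))
  M = majᵇ (descentWord (b ∷ r))
  step : ∀ c → (if c then i else 0) + (T * suc i + M) ≡ (if c then suc T else T) * i + (T + M)
  step true  = arith i T M
    where
    arith : ∀ i T M → i + (T * suc i + M) ≡ suc T * i + (T + M)
    arith = solve-∀
  step false = arith i T M
    where
    arith : ∀ i T M → T * suc i + M ≡ T * i + (T + M)
    arith = solve-∀

majFrom-padding : ∀ i {a s} → All (0 <_) (a ∷ s) →
                  majFrom i (a ∷ s ++ [ 0 ]) ≡ i + length s + majFrom i (a ∷ s)
majFrom-padding i {a} {[]} (0<a ∷ []) =
  trans (cong (λ c → (if c then i else 0) + 0) (dec-true (0 <? a) 0<a)) (sym (ℕ.+-identityʳ (i + 0)))
majFrom-padding i {a} {b ∷ s} (_ ∷ ps) =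
  trans (cong (_+_ d) (majFrom-padding (suc i) ps)) (arith d i (length s) (majFrom (suc i) (b ∷ s)))
  where
  d = if does (b <? a) then i else 0
  arith : ∀ d i l M → d + (suc i + l + M) ≡ i + suc l + (d + M)
  arith = solve-∀

linked-padded : ∀ {a s} → All (0 <_) (a ∷ s) → Unique (a ∷ s) → Linked _≢_ (padded (a ∷ s))
linked-padded (0<a ∷ ps) u = ℕ.<⇒≢ 0<a ∷ linked-suffix (0<a ∷ ps) u
  where
  linked-suffix : ∀ {a s} → All (0 <_) (a ∷ s) → Unique (a ∷ s) → Linked _≢_ (a ∷ s ++ [ 0 ])
  linked-suffix {s = []}    (0<a ∷ []) _               = ℕ.>⇒≢ 0<a ∷ [-]
  linked-suffix {s = _ ∷ _} (_ ∷ ps)   ((a≢b ∷ _) ∷ u) = a≢b ∷ linked-suffix ps u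

-- The final descent σₙ > 0 of 0σ0 contributes its position n to majᵇ, but nothing to maj σ.
statᵇ-padded : ∀ {n τ} → IsPermutation (suc n) τ →
               statᵇ (descentWord (padded τ)) ≡ shiftQ (suc n) (stat τ)
statᵇ-padded {τ = a ∷ s} record { length≡ = refl ; inRange = b ; unique = u } =
  cong⟨,,⟩ majᵇ-padded (falses-descentWord (linked-padded ps u)) (trues-descentWord (padded (a ∷ s)))
  where
  ps = All.map proj₁ b
  E = descentWord (a ∷ s ++ [ 0 ])
  majᵇ-padded : trues E + majᵇ E ≡ suc (length s) + maj (a ∷ s)
  majᵇ-padded = begin
    trues E + majᵇ E             ≡⟨ cong (_+ majᵇ E) (ℕ.*-identityʳ (trues E)) ⟨
    trues E * 1 + majᵇ E         ≡⟨ majFrom-descentWord 1 (a ∷ s ++ [ 0 ]) ⟨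
    majFrom 1 (a ∷ s ++ [ 0 ])   ≡⟨ majFrom-padding 1 ps ⟩
    suc (length s) + maj (a ∷ s) ∎
    where open ≡-Reasoning

peak-descentWord : ∀ {x m y} r → x < m → y < m →
                   descentWord (x ∷ m ∷ y ∷ r) ≡ false ∷ true ∷ descentWord (y ∷ r)
peak-descentWord {x} {m} {y} r x<m y<m =
  cong₂ (λ c d → c ∷ d ∷ descentWord (y ∷ r))
        (dec-false (m <? x) (ℕ.<⇒≯ x<m)) (dec-true (y <? m) y<m)

descentWord-insertions : ∀ {m x z} σ → x < m → z < m → All (_< m) σ →
  map (λ τ → descentWord (x ∷ τ ++ [ z ])) (insertions m σ)
  ≡ peakInsertions (descentWord (x ∷ σ ++ [ z ]))
descentWord-insertions [] x<m z<m [] = cong [_] (peak-descentWord [] x<m z<m)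
descentWord-insertions {m} {x} {z} (a ∷ σ) x<m z<m (a<m ∷ σ<m) = cong₂ _∷_
  (peak-descentWord (σ ++ [ z ]) x<m a<m)
  (begin
    map (λ τ → descentWord (x ∷ τ ++ [ z ])) (map (a ∷_) (insertions m σ))
      ≡⟨ map-fuse (λ _ → refl) (insertions m σ) ⟩
    map ((isDescent (x , a) ∷_) ∘ (λ τ → descentWord (a ∷ τ ++ [ z ]))) (insertions m σ)
      ≡⟨ map-∘ (insertions m σ) ⟩
    map (isDescent (x , a) ∷_) (map (λ τ → descentWord (a ∷ τ ++ [ z ])) (insertions m σ))
      ≡⟨ cong (map (isDescent (x , a) ∷_)) (descentWord-insertions σ a<m z<m σ<m) ⟩
    map (isDescent (x , a) ∷_) (peakInsertions (descentWord (a ∷ σ ++ [ z ]))) ∎)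
  where open ≡-Reasoning

stats-insertions : ∀ {n σ} → IsPermutation (suc n) σ →
                   map stat (insertions (suc (suc n)) σ) ↭ children (stat σ)
stats-insertions {n} {σ} p = ↭-map-cancel (shiftQ-injective (suc N)) (begin
  map (shiftQ (suc N)) (map stat (insertions (suc N) σ))
    ≡⟨ map-fuse (λ _ → refl) (insertions (suc N) σ) ⟩
  map (shiftQ (suc N) ∘ stat) (insertions (suc N) σ)
    ≡⟨ map-cong-local (All.tabulate (statᵇ-padded ∘ insertion-IsPermutation p)) ⟨
  map (statᵇ ∘ descentWord ∘ padded) (insertions (suc N) σ)
    ≡⟨ map-∘ (insertions (suc N) σ) ⟩
  map statᵇ (map (descentWord ∘ padded) (insertions (suc N) σ))
    ≡⟨ cong (map statᵇ) (descentWord-insertions σ z<s z<s (All.map (s≤s ∘ proj₂) (inRange p))) ⟩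
  map statᵇ (peakInsertions (descentWord (padded σ)))
    ↭⟨ statᵇ-peakInsertions (descentWord (padded σ)) ⟩
  children (shiftQ 1 (statᵇ (descentWord (padded σ))))
    ≡⟨ cong (children ∘ shiftQ 1) (statᵇ-padded p) ⟩
  children (shiftQ (suc N) (stat σ))
    ≡⟨ children-shiftQ (suc N) (stat σ) ⟨
  map (shiftQ (suc N)) (children (stat σ)) ∎)
  where
  open PermutationReasoning
  N = suc n

stats-𝔖-suc : ∀ n → map stat (𝔖 (suc (suc n))) ↭ concatMap children (map stat (𝔖 (suc n)))
stats-𝔖-suc n = begin
  map stat (𝔖 (suc m))                       ↭⟨ map⁺ stat (𝔖-suc m) ⟩
  map stat (concatMap (insertions (suc m)) (𝔖 m))
    ≡⟨ map-concatMap stat (insertions (suc m)) (𝔖 m) ⟩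
  concatMap (map stat ∘ insertions (suc m)) (𝔖 m)
    ↭⟨ concatMap-↭-local {xs = 𝔖 m} (All.tabulate (stats-insertions ∘ 𝔖-sound)) ⟩
  concatMap (children ∘ stat) (𝔖 m)          ≡⟨ concatMap-map children stat (𝔖 m) ⟨
  concatMap children (map stat (𝔖 m))        ∎
  where
  open PermutationReasoning
  m = suc n

generation-𝔖 : ∀ n → generation (suc n) ↭ map stat (𝔖 (suc n))
generation-𝔖 zero    = ↭-refl
generation-𝔖 (suc n) = ↭-trans (concatMap⁺ children (generation-𝔖 n)) (↭-sym (stats-𝔖-suc n))

↭⇒≈L : ∀ {P Q} → P ↭ Q → P ≈L Q
↭⇒≈L P↭Q _ _ _ =
  foldr-commMonoid ℤ.+-0-isCommutativeMonoid (↭⇒↭ₛ (map⁺ mcoef (filter-↭ _ P↭Q)))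

theorem5p3 : (n : ℕ) → n ≥ 1 →
    φ (Dⁿ n (tm (+ 1) 0 (x₀ ∷ []) ∷ [])) ≈L Amaj n
theorem5p3 (suc n) _ = ↭⇒≈L (begin
  φ (Dⁿ (suc n) seed)                        ≡⟨ φ-canonical (Canonical-Dⁿ (suc n)) ⟩
  map toMono (map weight (Dⁿ (suc n) seed))  ≡⟨ cong (map toMono) (weights-Dⁿ (suc n)) ⟩
  map toMono (generation (suc n))            ↭⟨ map⁺ toMono (generation-𝔖 n) ⟩
  map toMono (map stat (𝔖 (suc n)))          ≡⟨ map-∘ (𝔖 (suc n)) ⟨
  Amaj (suc n)                               ∎)
  where open PermutationReasoning
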